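{- For every $\delta\in\mathbb{N}_+$ there exist $r_1,r_2\in\mathbb{Z}$ and a sequence of integers $(U_n)_{n\ge0}$ with $U_n=r_1U_{n-1}+r_2U_{n-2}$ for all $n\ge2$, such that the discriminant $\Delta=r_1^2+4r_2$ of $x^2-r_1x-r_2$ satisfies $\sqrt{\Delta}=\delta$ and $\operatorname{rad}(\Delta)$ divides $\operatorname{fail}(\mathbf U)$.
   Context: A sequence of integers $(A_n)_{n\ge1}$ satisfies the Dold condition if $n\mid\sum_{d\mid n}\mu(d)A_{n/d}$ for every $n\in\mathbb{N}_+$ ($\mu$ the Möbius function). For a sequence $\mathbf U$, $\operatorname{fail}(\mathbf U)$ is the least positive integer $c$ such that $(cU_n)_{n\ge1}$ satisfies the Dold condition ($\infty$ if no such $c$ exists). For a nonzero integer $m$, $\operatorname{rad}(m)$ denotes the product of the distinct primes dividing $m$. -}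

module Defs where

open import Data.Nat as ℕ using (ℕ; zero; suc; _≤_)
open import Data.Nat.Divisibility using (_∣?_)
open import Data.Nat.DivMod using (_/_)
open import Data.Nat.Primality using (Prime; prime?)
open import Data.Integer as ℤ using (ℤ; +_; 0ℤ; 1ℤ; -1ℤ)
import Data.Integer.Divisibility as ℤD
open import Data.List using (List; []; _∷_; filter; upTo; map; foldr; length)
open import Data.Nat.ListAction using (product)
open import Data.Bool.ListAction using (any)
open import Data.Product using (_×_)
open import Relation.Nullary.Decidable using (_×-dec_; does)
open import Data.Bool using (if_then_else_)

sumℤ : List ℤ → ℤ
sumℤ = foldr ℤ._+_ 0ℤ

primeDivisors : ℕ → List ℕ
primeDivisors m = filter (λ p → prime? p ×-dec (p ∣? m)) (upTo (suc m))

rad : ℕ → ℕ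
rad m = product (primeDivisors m)

μ : ℕ → ℤ
μ n = if any (λ p → does (p ℕ.* p ∣? n)) (primeDivisors n)
        then 0ℤ
        else (-1ℤ ℤ.^ length (primeDivisors n))

-- Σ_{d ∣ n} μ(d) A(n/d), for n ≥ 1 (d ranges over 1..n)
doldSum : (ℕ → ℤ) → ℕ → ℤ
doldSum A n = sumℤ (map (λ k → if does (suc k ∣? n) then μ (suc k) ℤ.* A (n / suc k) else 0ℤ) (upTo n))

-- Dold condition for (A_n)_{n ≥ 1}; the value A 0 is irrelevant
Dold : (ℕ → ℤ) → Set
Dold A = ∀ (n : ℕ) → 1 ≤ n → (+ n) ℤD.∣ doldSum A n

-- fail(U) = c (finite): c is the least positive integer with (c U_n) Dold
IsFail : (ℕ → ℤ) → ℕ → Set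
IsFail U c = (1 ≤ c) × Dold (λ n → + c ℤ.* U n)
             × (∀ (c' : ℕ) → 1 ≤ c' → Dold (λ n → + c' ℤ.* U n) → c ≤ c')

{-# OPTIONS --safe #-}

-- Take r₁ = δ, r₂ = 0 and U = (0, 1, δ, δ², …), so that Δ = δ². Möbius inversion at a prime p
-- writes the Dold sum of a sequence A at p·m as a combination, over the divisors d of m prime to
-- p, of the differences A(p·m/d) − A(m/d); hence A is Dold as soon as p^(j+1) ∣ A(p n) − A(n)
-- whenever p^j ∣ n. For A = c·U this difference is c δ^(n−1) (δ^((p−1) n) − 1): if p ∣ δ the
-- first factor supplies p^(j+1) provided p ∣ c, and if p ∤ δ the second one does, by Fermat's
-- little theorem lifted to p^(j+1). Conversely, at n = p the Dold condition for c·U says that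
-- p ∣ c (δ^(p−1) − 1), which forces p ∣ c for every prime p ∣ δ. So fail(U) = rad(δ) = rad(δ²).

module Submission where

open import Defs
open import Data.Nat as ℕ using (ℕ; _≤_)
import Data.Nat.Properties as ℕP
open import Data.Nat.Divisibility as ℕ∣ using (_∣_; divides; _∣?_)
open import Data.Nat.Primality using (Prime; prime⇒irreducible; prime⇒nonZero; euclidsLemma; ¬prime[1])
open import Data.Integer as ℤ using (ℤ; +_; 0ℤ)
import Data.Integer.Properties as ℤP
open import Data.Product using (_×_; _,_; proj₁; proj₂; ∃-syntax)
open import Data.Sum using (inj₁; inj₂)
open import Data.Empty using (⊥-elim)
open import Function using (_∘_)
open import Relation.Nullary using (¬_; yes; no)
open import Relation.Binary.PropositionalEquality

module Divisibility where

  open import Data.Nat using (zero; suc; _+_; _*_; _^_; _∸_; _<_; z≤n; s≤s; _!; NonZero)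
  open ℕ∣ using (∣-refl; ∣-trans; m∣m*n; ∣n⇒∣m*n; *-monoʳ-∣; *-monoˡ-∣; *-cancelˡ-∣; ∣⇒≤; 1∣_)
  open import Data.Nat.Properties using (_!*_!≢0)
  open import Data.Nat.DivMod using (_/_; m/n*n≡m)
  open import Data.Nat.Combinatorics using (_C_; nCk≡n!/k![n-k]!; k![n∸k]!∣n!)
  open import Data.Nat.Coprimality using (Coprime; coprime-divisor)
  open import Data.Nat.Primality.Factorisation using (factorise; PrimeFactorisation)
  open import Data.Nat.ListAction using (product)
  open import Data.List using ([]; _∷_)
  open import Data.List.Relation.Unary.All using (All; []; _∷_)

  private
    variable
      c d k m n p q : ℕ

  prime∤1 : Prime p → ¬ p ∣ 1
  prime∤1 pp p∣1 with ℕ∣.∣1⇒≡1 p∣1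
  ... | refl = ¬prime[1] pp

  prime∣prime⇒≡ : Prime q → Prime p → q ∣ p → q ≡ p
  prime∣prime⇒≡ pq pp q∣p with prime⇒irreducible pp q∣p
  ... | inj₁ refl = ⊥-elim (¬prime[1] pq)
  ... | inj₂ q≡p  = q≡p

  prime∤⇒coprime : Prime p → ¬ p ∣ n → Coprime p n
  prime∤⇒coprime pp p∤n (i∣p , i∣n) with prime⇒irreducible pp i∣p
  ... | inj₁ i≡1  = i≡1
  ... | inj₂ refl = ⊥-elim (p∤n i∣n)

  coprime⇒*∣ : Coprime m n → m ∣ c → n ∣ c → m * n ∣ c
  coprime⇒*∣ {m} {n} cop m∣c (divides k refl) =
    *-monoˡ-∣ n (coprime-divisor cop (subst (m ∣_) (ℕP.*-comm k n) m∣c))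

  prime^k∣d*n⇒prime^k∣n : Prime p → ¬ p ∣ d → ∀ k → p ^ k ∣ d * n → p ^ k ∣ n
  prime^k∣d*n⇒prime^k∣n pp p∤d zero    _ = 1∣ _
  prime^k∣d*n⇒prime^k∣n {p} {d} {n} pp p∤d (suc k) pᵏ⁺¹∣dn
    with euclidsLemma d n pp (∣-trans (m∣m*n (p ^ k)) pᵏ⁺¹∣dn)
  ... | inj₁ p∣d                 = ⊥-elim (p∤d p∣d)
  ... | inj₂ (divides n′ refl) = subst (p ^ suc k ∣_) (ℕP.*-comm p n′) (*-monoʳ-∣ p pᵏ∣n′)
    where
    pᵏ∣n′ : p ^ k ∣ n′
    pᵏ∣n′ = prime^k∣d*n⇒prime^k∣n pp p∤d k (*-cancelˡ-∣ p {{prime⇒nonZero pp}}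
      (subst (p * p ^ k ∣_) (trans (sym (ℕP.*-assoc d n′ p)) (ℕP.*-comm (d * n′) p)) pᵏ⁺¹∣dn))

  primePowers∣⇒product∣ : ∀ {as x} → All Prime as →
    (∀ {p} k → Prime p → p ^ k ∣ product as → p ^ k ∣ x) → product as ∣ x
  primePowers∣⇒product∣ [] _ = 1∣ _
  primePowers∣⇒product∣ {a ∷ as} {x} (pa ∷ pas) primePowers∣x
    with subst (_∣ x) (ℕP.*-identityʳ a)
           (primePowers∣x 1 pa (subst (_∣ a * product as) (sym (ℕP.*-identityʳ a)) (m∣m*n (product as))))
  ... | divides y refl = subst (a * product as ∣_) (ℕP.*-comm a y)
          (*-monoʳ-∣ a (primePowers∣⇒product∣ pas primePowers∣y))
    where
    primePowers∣y : ∀ {p} k → Prime p → p ^ k ∣ product as → p ^ k ∣ y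
    primePowers∣y {p} k pp pᵏ∣ with p ℕP.≟ a
    ... | yes refl = *-cancelˡ-∣ p {{prime⇒nonZero pp}}
          (subst (p * p ^ k ∣_) (ℕP.*-comm y p) (primePowers∣x (suc k) pp (*-monoʳ-∣ p pᵏ∣)))
    ... | no p≢a   = prime^k∣d*n⇒prime^k∣n pp (p≢a ∘ prime∣prime⇒≡ pp pa) k
          (subst (p ^ k ∣_) (ℕP.*-comm y a) (primePowers∣x k pp (∣n⇒∣m*n a pᵏ∣)))

  primePowers∣⇒∣ : ∀ {x} → .{{NonZero n}} →
    (∀ {p} k → Prime p → p ^ k ∣ n → p ^ k ∣ x) → n ∣ x
  primePowers∣⇒∣ {n} primePowers∣x = subst (_∣ _) (sym isFactorisation)
    (primePowers∣⇒product∣ factorsPrime (λ k pp → primePowers∣x k pp ∘ subst (_ ∣_) (sym isFactorisation)))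
    where open PrimeFactorisation (factorise n)

  ^-monoˡ-∣ : ∀ k → m ∣ n → m ^ k ∣ n ^ k
  ^-monoˡ-∣ zero    _   = ∣-refl
  ^-monoˡ-∣ (suc k) m∣n = ℕ∣.*-pres-∣ m∣n (^-monoˡ-∣ k m∣n)

  ^-monoʳ-∣ : ∀ m → k ≤ n → m ^ k ∣ m ^ n
  ^-monoʳ-∣ {k} {n} m k≤n = divides (m ^ (n ∸ k)) (begin
    m ^ n               ≡⟨ cong (m ^_) (ℕP.m+[n∸m]≡n k≤n) ⟨
    m ^ (k + (n ∸ k))   ≡⟨ ℕP.^-distribˡ-+-* m k (n ∸ k) ⟩
    m ^ k * m ^ (n ∸ k) ≡⟨ ℕP.*-comm (m ^ k) _ ⟩
    m ^ (n ∸ k) * m ^ k ∎)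
    where open ≡-Reasoning

  n<m^n : 1 < m → ∀ n → n < m ^ n
  n<m^n 1<m zero        = s≤s z≤n
  n<m^n {m} 1<m (suc n) = begin-strict
    suc n         <⟨ s≤s (n<m^n 1<m n) ⟩
    suc (m ^ n)   ≤⟨ ℕP.+-monoˡ-≤ (m ^ n) (ℕP.≤-trans (s≤s z≤n) (n<m^n 1<m n)) ⟩
    m ^ n + m ^ n ≡⟨ cong (_+_ (m ^ n)) (ℕP.+-identityʳ (m ^ n)) ⟨
    2 * m ^ n     ≤⟨ ℕP.*-monoˡ-≤ (m ^ n) 1<m ⟩
    m * m ^ n     ∎
    where open ℕP.≤-Reasoning

  prime∤m! : Prime p → m < p → ¬ p ∣ m !
  prime∤m! {m = zero}  pp _   = prime∤1 pp
  prime∤m! {m = suc m} pp m<p p∣m! with euclidsLemma (suc m) (m !) pp p∣m!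
  ... | inj₁ p∣1+m = ℕP.<⇒≱ m<p (∣⇒≤ p∣1+m)
  ... | inj₂ p∣m!  = prime∤m! pp (ℕP.<⇒≤ m<p) p∣m!

  prime∣pCk : Prime p → 0 < k → k < p → p ∣ p C k
  prime∣pCk {p@(suc p-1)} {k} pp 0<k k<p with euclidsLemma (k ! * (p ∸ k) !) (p C k) pp p∣k![p-k]!pCk
    where
    instance
      k![p-k]!≢0 : NonZero (k ! * (p ∸ k) !)
      k![p-k]!≢0 = k !* (p ∸ k) !≢0
    p∣k![p-k]!pCk : p ∣ k ! * (p ∸ k) ! * (p C k)
    p∣k![p-k]!pCk = subst (p ∣_) (sym (begin
      k ! * (p ∸ k) ! * (p C k)
        ≡⟨ ℕP.*-comm (k ! * (p ∸ k) !) _ ⟩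
      (p C k) * (k ! * (p ∸ k) !)
        ≡⟨ cong (_* (k ! * (p ∸ k) !)) (nCk≡n!/k![n-k]! (ℕP.<⇒≤ k<p)) ⟩
      p ! / (k ! * (p ∸ k) !) * (k ! * (p ∸ k) !)
        ≡⟨ m/n*n≡m (k![n∸k]!∣n! (ℕP.<⇒≤ k<p)) ⟩
      p !
        ∎)) (m∣m*n (p-1 !))
      where open ≡-Reasoning
  ... | inj₂ p∣pCk = p∣pCk
  ... | inj₁ p∣k![p-k]! with euclidsLemma (k !) ((p ∸ k) !) pp p∣k![p-k]!
  ...   | inj₁ p∣k!     = ⊥-elim (prime∤m! pp k<p p∣k!)
  ...   | inj₂ p∣[p-k]! = ⊥-elim (prime∤m! pp (ℕP.∸-monoʳ-< 0<k (ℕP.<⇒≤ k<p)) p∣[p-k]!)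

module PrimeDivisors where

  open Divisibility
  open import Data.Nat using (suc; s≤s; NonZero)
  open ℕ∣ using (∣⇒≤; 1∣_)
  open import Data.Nat.Primality using (prime?; productOfPrimes≥1)
  open import Data.Nat.Primality.Factorisation using (factorisationHasAllPrimeFactors)
  open import Data.Nat.ListAction using (product)
  open import Data.Nat.ListAction.Properties using (∈⇒∣product)
  open import Data.List using ([]; _∷_; upTo)
  open import Data.List.Membership.Propositional using (_∈_)
  open import Data.List.Membership.Propositional.Properties using (∈-filter⁺; ∈-filter⁻; ∈-upTo⁺)
  open import Data.List.Relation.Unary.All as All using (All; []; _∷_)
  open import Data.List.Relation.Unary.Unique.Propositional using (Unique; []; _∷_)
  import Data.List.Relation.Unary.Unique.Propositional.Properties as Unique
  open import Relation.Nullary.Decidable using (_×-dec_)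

  private
    variable
      c m p q : ℕ

  ∈-primeDivisors⁻ : ∀ m → q ∈ primeDivisors m → Prime q × q ∣ m
  ∈-primeDivisors⁻ m = proj₂ ∘ ∈-filter⁻ (λ q → prime? q ×-dec (q ∣? m)) {xs = upTo (suc m)}

  ∈-primeDivisors⁺ : .{{NonZero m}} → Prime q → q ∣ m → q ∈ primeDivisors m
  ∈-primeDivisors⁺ {m} pq q∣m =
    ∈-filter⁺ (λ q → prime? q ×-dec (q ∣? m)) (∈-upTo⁺ (s≤s (∣⇒≤ q∣m))) (pq , q∣m)

  primeDivisors-unique : ∀ m → Unique (primeDivisors m)
  primeDivisors-unique m = Unique.filter⁺ (λ q → prime? q ×-dec (q ∣? m)) (Unique.upTo⁺ (suc m))

  primeDivisors-prime : ∀ m → All Prime (primeDivisors m)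
  primeDivisors-prime m = All.tabulate (proj₁ ∘ ∈-primeDivisors⁻ m)

  rad≥1 : ∀ m → 1 ≤ rad m
  rad≥1 m = productOfPrimes≥1 (primeDivisors-prime m)

  prime∣⇒∣rad : .{{NonZero m}} → Prime p → p ∣ m → p ∣ rad m
  prime∣⇒∣rad pp p∣m = ∈⇒∣product (∈-primeDivisors⁺ pp p∣m)

  distinctPrimes∣⇒product∣ : ∀ {ps} → Unique ps → All Prime ps → All (_∣ c) ps → product ps ∣ c
  distinctPrimes∣⇒product∣ [] [] [] = 1∣ _
  distinctPrimes∣⇒product∣ {ps = p ∷ ps} (p∉ps ∷ ups) (pp ∷ pps) (p∣c ∷ ps∣c) =
    coprime⇒*∣ (prime∤⇒coprime pp p∤product) p∣c (distinctPrimes∣⇒product∣ ups pps ps∣c)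
    where
    p∤product : ¬ p ∣ product ps
    p∤product p∣ = All.lookup p∉ps (factorisationHasAllPrimeFactors pp p∣ pps) refl

  rad∣ : ∀ m → (∀ {p} → Prime p → p ∣ m → p ∣ c) → rad m ∣ c
  rad∣ m primes∣c = distinctPrimes∣⇒product∣ (primeDivisors-unique m) (primeDivisors-prime m)
    (All.tabulate (λ q∈ → let pq , q∣m = ∈-primeDivisors⁻ m q∈ in primes∣c pq q∣m))

module Möbius where

  open Divisibility
  open PrimeDivisors
  open import Data.Nat using (suc; _*_; NonZero)
  open ℕ∣ using (∣-trans; ∣n⇒∣m*n; m∣m*n; *-cancelˡ-∣)
  open import Data.Integer using (-1ℤ; -_; _^_)
  open import Data.Bool using (Bool; true; false; T; if_then_else_)
  open import Data.Bool.Properties using (T-≡)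
  open import Data.Bool.ListAction using (any)
  open import Data.List using (_∷_; length)
  open import Data.List.Membership.Propositional using (_∈_; find; lose)
  open import Data.List.Membership.Propositional.Properties.WithK using (unique∧set⇒bag)
  open import Data.List.Relation.Unary.All as All using ()
  open import Data.List.Relation.Unary.Any using (here; there)
  open import Data.List.Relation.Unary.Any.Properties using (any⇔)
  open import Data.List.Relation.Unary.Unique.Propositional using (_∷_)
  open import Data.List.Relation.Binary.BagAndSetEquality using (∼bag⇒↭)
  open import Data.List.Relation.Binary.Permutation.Propositional using (_↭_)
  open import Data.List.Relation.Binary.Permutation.Propositional.Properties using (↭-length)
  open import Function.Bundles using (_⇔_; mk⇔; module Equivalence)
  open import Relation.Nullary using (Dec; does)
  open import Relation.Nullary.Reflects using (fromEquivalence; T-reflects; det)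

  private
    variable
      e n p q : ℕ

  T-does⇔ : ∀ {A : Set} (A? : Dec A) → T (does A?) ⇔ A
  T-does⇔ (yes a) = mk⇔ (λ _ → a) _
  T-does⇔ (no ¬a) = mk⇔ (λ ()) ¬a

  -- μ n branches on exactly this test.
  hasPrimeSquareDivisor : ℕ → Bool
  hasPrimeSquareDivisor n = any (λ q → does (q * q ∣? n)) (primeDivisors n)

  PrimeSquareDivides : ℕ → Set
  PrimeSquareDivides n = ∃[ q ] Prime q × q * q ∣ n

  T-hasPrimeSquareDivisor⇔ : .{{NonZero n}} → T (hasPrimeSquareDivisor n) ⇔ PrimeSquareDivides n
  T-hasPrimeSquareDivisor⇔ {n} = mk⇔ to from
    where
    to : T (hasPrimeSquareDivisor n) → PrimeSquareDivides n
    to t with q , q∈ , q²∣? ← find (Equivalence.from any⇔ t) =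
      q , proj₁ (∈-primeDivisors⁻ n q∈) , Equivalence.to (T-does⇔ (q * q ∣? n)) q²∣?
    from : PrimeSquareDivides n → T (hasPrimeSquareDivisor n)
    from (q , pq , q²∣n) = Equivalence.to any⇔ (lose (∈-primeDivisors⁺ pq (∣-trans (m∣m*n q) q²∣n))
      (Equivalence.from (T-does⇔ (q * q ∣? n)) q²∣n))

  primeSquareDivides-*⇔ : Prime p → ¬ p ∣ e → PrimeSquareDivides (p * e) ⇔ PrimeSquareDivides e
  primeSquareDivides-*⇔ {p} {e} pp p∤e = mk⇔ to from
    where
    to : PrimeSquareDivides (p * e) → PrimeSquareDivides e
    to (q , pq , q²∣pe) with q ∣? p
    ... | yes q∣p rewrite prime∣prime⇒≡ pq pp q∣p = ⊥-elim (p∤e (*-cancelˡ-∣ p {{prime⇒nonZero pp}} q²∣pe))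
    ... | no q∤p = q , pq , subst (_∣ e) q²≡q*q
      (prime^k∣d*n⇒prime^k∣n pq q∤p 2 (subst (_∣ p * e) (sym q²≡q*q) q²∣pe))
      where
      q²≡q*q : q ℕ.^ 2 ≡ q * q
      q²≡q*q = cong (q *_) (ℕP.*-identityʳ q)
    from : PrimeSquareDivides e → PrimeSquareDivides (p * e)
    from (q , pq , q²∣e) = q , pq , ∣n⇒∣m*n p q²∣e

  primeDivisors-* : Prime p → ¬ p ∣ e → .{{NonZero e}} → primeDivisors (p * e) ↭ p ∷ primeDivisors e
  primeDivisors-* {p} {e} pp p∤e = ∼bag⇒↭ (unique∧set⇒bag
    (primeDivisors-unique (p * e)) (p∉primeDivisors ∷ primeDivisors-unique e) (mk⇔ to from))
    where
    instance
      pe≢0 : NonZero (p * e)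
      pe≢0 = ℕP.m*n≢0 p e {{prime⇒nonZero pp}}
    p∉primeDivisors : All.All (p ≢_) (primeDivisors e)
    p∉primeDivisors = All.tabulate λ q∈ p≡q → p∤e (subst (_∣ e) (sym p≡q) (proj₂ (∈-primeDivisors⁻ e q∈)))
    to : q ∈ primeDivisors (p * e) → q ∈ p ∷ primeDivisors e
    to q∈ with pq , q∣pe ← ∈-primeDivisors⁻ (p * e) q∈ | euclidsLemma p e pq q∣pe
    ... | inj₁ q∣p = here (prime∣prime⇒≡ pq pp q∣p)
    ... | inj₂ q∣e = there (∈-primeDivisors⁺ pq q∣e)
    from : q ∈ p ∷ primeDivisors e → q ∈ primeDivisors (p * e)
    from (here refl) = ∈-primeDivisors⁺ pp (m∣m*n e)
    from (there q∈) with pq , q∣e ← ∈-primeDivisors⁻ e q∈ = ∈-primeDivisors⁺ pq (∣n⇒∣m*n p q∣e)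

  μ-primeSquare : .{{NonZero n}} → Prime q → q * q ∣ n → μ n ≡ 0ℤ
  μ-primeSquare {n} {q} pq q²∣n = cong (λ b → if b then 0ℤ else -1ℤ ^ length (primeDivisors n))
    (Equivalence.to T-≡ (Equivalence.from T-hasPrimeSquareDivisor⇔ (q , pq , q²∣n)))

  μ-p*e : Prime p → ¬ p ∣ e → .{{NonZero e}} → μ (p * e) ≡ - μ e
  μ-p*e {p} {e} pp p∤e = trans
    (cong₂ (λ b l → if b then 0ℤ else -1ℤ ^ l) squareTest≡ (↭-length (primeDivisors-* pp p∤e)))
    (negate (hasPrimeSquareDivisor e))
    where
    instance
      pe≢0 : NonZero (p * e)
      pe≢0 = ℕP.m*n≢0 p e {{prime⇒nonZero pp}}
    open Equivalence
    squareTest≡ : hasPrimeSquareDivisor (p * e) ≡ hasPrimeSquareDivisor e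
    squareTest≡ = det (fromEquivalence (from T⇔ ∘ to squares⇔ ∘ to T⇔) (from T⇔ ∘ from squares⇔ ∘ to T⇔))
                      (T-reflects _)
      where
      T⇔ : ∀ {n} .{{_ : NonZero n}} → T (hasPrimeSquareDivisor n) ⇔ PrimeSquareDivides n
      T⇔ = T-hasPrimeSquareDivisor⇔
      squares⇔ : PrimeSquareDivides (p * e) ⇔ PrimeSquareDivides e
      squares⇔ = primeSquareDivides-*⇔ pp p∤e
    negate : ∀ b → (if b then 0ℤ else -1ℤ ^ suc (length (primeDivisors e)))
                 ≡ - (if b then 0ℤ else -1ℤ ^ length (primeDivisors e))
    negate true  = refl
    negate false = ℤP.-1*i≡-i _

module FiniteSums where

  open import Data.Nat using (zero; suc; _<_; z≤n; s≤s; NonZero)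
  open ℕ∣ using (∣-refl; ∣⇒≤; ∣m+n∣m⇒∣n; ∣m∣n⇒∣m+n)
  open import Data.Integer using (_+_)
  open import Data.Integer.Divisibility.Signed as ℤ∣ using () renaming (_∣_ to _∣ᶻ_)
  open import Data.Integer.Solver using (module +-*-Solver)
  open import Data.Bool using (if_then_else_)
  open import Data.List using (applyUpTo)
  open import Function.Bundles using (_⇔_; mk⇔)
  open import Relation.Nullary using (Dec; does)
  open import Relation.Nullary.Decidable using (dec-true; dec-false; does-⇔; ¬?)

  private
    variable
      A B : Set
      m n : ℕ
      f g : ℕ → ℤ
      d x y : ℤ

  ∑< : ℕ → (ℕ → ℤ) → ℤ
  ∑< n f = sumℤ (applyUpTo f n)

  infix 5 ∑<
  syntax ∑< n (λ k → e) = ∑[ k < n ] e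

  ∑-cong : (∀ {k} → k < n → f k ≡ g k) → ∑< n f ≡ ∑< n g
  ∑-cong {zero}  _  = refl
  ∑-cong {suc n} eq = cong₂ _+_ (eq (s≤s z≤n)) (∑-cong (eq ∘ s≤s))

  ∑-zero : (∀ {k} → k < n → f k ≡ 0ℤ) → ∑< n f ≡ 0ℤ
  ∑-zero {zero}  _  = refl
  ∑-zero {suc n} eq = cong₂ _+_ (eq (s≤s z≤n)) (∑-zero (eq ∘ s≤s))

  ∑-init-last : ∀ n f → ∑< (suc n) f ≡ ∑< n f + f n
  ∑-init-last zero    f = trans (ℤP.+-identityʳ (f 0)) (sym (ℤP.+-identityˡ (f 0)))
  ∑-init-last (suc n) f = trans (cong (_+_ (f 0)) (∑-init-last n (f ∘ suc)))
    (sym (ℤP.+-assoc (f 0) (∑< n (f ∘ suc)) (f (suc n))))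

  ∑-split : ∀ m n f → ∑< (m ℕ.+ n) f ≡ ∑< m f + (∑[ k < n ] f (m ℕ.+ k))
  ∑-split zero    n f = sym (ℤP.+-identityˡ _)
  ∑-split (suc m) n f = trans (cong (_+_ (f 0)) (∑-split m n (f ∘ suc))) (sym (ℤP.+-assoc (f 0) _ _))

  ∑-distrib-+ : ∀ n f g → ∑[ k < n ] f k + g k ≡ ∑< n f + ∑< n g
  ∑-distrib-+ zero    f g = refl
  ∑-distrib-+ (suc n) f g = trans (cong (_+_ (f 0 + g 0)) (∑-distrib-+ n (f ∘ suc) (g ∘ suc)))
    (solve 4 (λ a b c d → (a :+ b) :+ (c :+ d) := (a :+ c) :+ (b :+ d)) refl (f 0) (g 0) _ _)
    where open +-*-Solver

  ∑-truncate : m ≤ n → (∀ {k} → m ≤ k → f k ≡ 0ℤ) → ∑< n f ≡ ∑< m f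
  ∑-truncate {m} {n} {f} m≤n vanish = begin
    ∑< n f
      ≡⟨ cong (λ l → ∑< l f) (ℕP.m+[n∸m]≡n m≤n) ⟨
    ∑< (m ℕ.+ (n ℕ.∸ m)) f
      ≡⟨ ∑-split m (n ℕ.∸ m) f ⟩
    ∑< m f + (∑[ k < n ℕ.∸ m ] f (m ℕ.+ k))
      ≡⟨ cong (_+_ (∑< m f)) (∑-zero {n ℕ.∸ m} (λ _ → vanish (ℕP.m≤m+n m _))) ⟩
    ∑< m f + 0ℤ
      ≡⟨ ℤP.+-identityʳ _ ⟩
    ∑< m f
      ∎
    where open ≡-Reasoning

  ∣-∑ : (∀ {k} → k < n → d ∣ᶻ f k) → d ∣ᶻ ∑< n f
  ∣-∑ {zero}  _   = ℤ∣.divides 0ℤ refl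
  ∣-∑ {suc n} d∣f = ℤ∣.∣m∣n⇒∣m+n (d∣f (s≤s z≤n)) (∣-∑ (d∣f ∘ s≤s))

  infixl 5 _when_

  _when_ : ℤ → Dec A → ℤ
  x when A? = if does A? then x else 0ℤ

  when-yes : (A? : Dec A) → A → x when A? ≡ x
  when-yes {x = x} A? a = cong (if_then x else 0ℤ) (dec-true A? a)

  when-no : (A? : Dec A) → ¬ A → x when A? ≡ 0ℤ
  when-no {x = x} A? ¬a = cong (if_then x else 0ℤ) (dec-false A? ¬a)

  when-⇔ : A ⇔ B → (A? : Dec A) (B? : Dec B) → x when A? ≡ x when B?
  when-⇔ {x = x} A⇔B A? B? = cong (if_then x else 0ℤ) (does-⇔ A⇔B A? B?)

  when-split : (A? : Dec A) → x ≡ (x when ¬? A?) + (x when A?)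
  when-split (yes _) = sym (ℤP.+-identityˡ _)
  when-split (no _)  = sym (ℤP.+-identityʳ _)

  when-+ : (A? : Dec A) → (x when A?) + (y when A?) ≡ (x + y) when A?
  when-+ (yes _) = refl
  when-+ (no _)  = refl

  ∣-when : (A? : Dec A) → (A → d ∣ᶻ x) → d ∣ᶻ x when A?
  ∣-when (yes a) d∣x = d∣x a
  ∣-when (no _)  _   = ℤ∣.divides 0ℤ refl

  ∑-multiples : ∀ p .{{_ : NonZero p}} m (f : ℕ → ℤ) →
    ∑[ k < p ℕ.* m ] (f (suc k) when (p ∣? suc k)) ≡ ∑[ e < m ] f (p ℕ.* suc e)
  ∑-multiples p@(suc q) zero    f = cong (λ l → ∑[ k < l ] (f (suc k) when (p ∣? suc k))) (ℕP.*-zeroʳ q)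
  ∑-multiples p@(suc q) (suc m) f = begin
    ∑< (p ℕ.* suc m) h
      ≡⟨ cong (λ l → ∑< l h) (ℕP.*-suc p m) ⟩
    ∑< (p ℕ.+ p ℕ.* m) h
      ≡⟨ ∑-split p (p ℕ.* m) h ⟩
    ∑< p h + (∑[ k < p ℕ.* m ] h (p ℕ.+ k))
      ≡⟨ cong₂ _+_ firstBlock (∑-cong {p ℕ.* m} (λ {k} _ → shift k)) ⟩
    f (p ℕ.* 1) + (∑[ k < p ℕ.* m ] (f (p ℕ.+ suc k) when (p ∣? suc k)))
      ≡⟨ cong (_+_ (f (p ℕ.* 1))) (∑-multiples p m (f ∘ (p ℕ.+_))) ⟩
    f (p ℕ.* 1) + (∑[ e < m ] f (p ℕ.+ p ℕ.* suc e))
      ≡⟨ cong (_+_ (f (p ℕ.* 1))) (∑-cong {m} (λ {e} _ → cong f (ℕP.*-suc p (suc e)))) ⟨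
    ∑[ e < suc m ] f (p ℕ.* suc e)
      ∎
    where
    open ≡-Reasoning
    h : ℕ → ℤ
    h k = f (suc k) when (p ∣? suc k)
    firstBlock : ∑< p h ≡ f (p ℕ.* 1)
    firstBlock = begin
      ∑< p h       ≡⟨ ∑-init-last q h ⟩
      ∑< q h + h q ≡⟨ cong₂ _+_ (∑-zero {q} (λ k<q → when-no (p ∣? _) (ℕP.<⇒≱ (s≤s k<q) ∘ ∣⇒≤)))
                                (when-yes (p ∣? p) ∣-refl) ⟩
      0ℤ + f p     ≡⟨ ℤP.+-identityˡ (f p) ⟩
      f p          ≡⟨ cong f (ℕP.*-identityʳ p) ⟨
      f (p ℕ.* 1)  ∎
    shift : ∀ k → h (p ℕ.+ k) ≡ f (p ℕ.+ suc k) when (p ∣? suc k)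
    shift k = begin
      f (suc (p ℕ.+ k)) when (p ∣? suc (p ℕ.+ k))
        ≡⟨ cong (λ l → f l when (p ∣? l)) (ℕP.+-suc p k) ⟨
      f (p ℕ.+ suc k) when (p ∣? (p ℕ.+ suc k))
        ≡⟨ when-⇔ p∣p+l⇔p∣l (p ∣? (p ℕ.+ suc k)) (p ∣? suc k) ⟩
      f (p ℕ.+ suc k) when (p ∣? suc k)
        ∎
      where
      p∣p+l⇔p∣l : p ∣ p ℕ.+ suc k ⇔ p ∣ suc k
      p∣p+l⇔p∣l = mk⇔ (λ p∣p+l → ∣m+n∣m⇒∣n p∣p+l ∣-refl) (∣m∣n⇒∣m+n ∣-refl)

module PowerCongruences where

  open Divisibility
  open FiniteSums
  open import Data.Nat using (zero; suc; _<_; z≤n; s≤s)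
  open import Data.Nat.Combinatorics using (_C_; nCn≡1)
  open import Data.Integer using (1ℤ; _+_; _-_; _*_; _^_; ∣_∣)
  open import Data.Integer.Divisibility.Signed as ℤ∣ using (divides; ∣ᵤ⇒∣; ∣⇒∣ᵤ) renaming (_∣_ to _∣ᶻ_)
  open import Data.Integer.Solver using (module +-*-Solver)
  open import Data.Fin using (toℕ)
  open import Algebra.Definitions.RawMonoid ℤ.+-0-rawMonoid using (sum) renaming (_×_ to _×ᶻ_)
  open import Algebra.Definitions.RawSemiring ℤ.+-*-rawSemiring using () renaming (_^_ to _^′_)
  open import Algebra.Properties.CommutativeSemiring.Binomial ℤP.+-*-commutativeSemiring
    using () renaming (theorem to binomialTheorem)
  open +-*-Solver

  private
    variable
      p x : ℕ

  pos-^ : ∀ m n → + (m ℕ.^ n) ≡ (+ m) ^ n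
  pos-^ m zero    = refl
  pos-^ m (suc n) = trans (ℤP.pos-* m (m ℕ.^ n)) (cong (+ m *_) (pos-^ m n))

  geometric : ∀ x n → (x - 1ℤ) * (∑[ i < n ] x ^ i) ≡ x ^ n - 1ℤ
  geometric x zero    = ℤP.*-zeroʳ (x - 1ℤ)
  geometric x (suc n) = begin
    (x - 1ℤ) * ∑< (suc n) (x ^_)              ≡⟨ cong ((x - 1ℤ) *_) (∑-init-last n (x ^_)) ⟩
    (x - 1ℤ) * (∑< n (x ^_) + x ^ n)          ≡⟨ ℤP.*-distribˡ-+ (x - 1ℤ) _ _ ⟩
    (x - 1ℤ) * ∑< n (x ^_) + (x - 1ℤ) * x ^ n ≡⟨ cong (_+ (x - 1ℤ) * x ^ n) (geometric x n) ⟩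
    x ^ n - 1ℤ + (x - 1ℤ) * x ^ n             ≡⟨ solve 2 (λ x y → y :- con 1ℤ :+ (x :- con 1ℤ) :* y
                                                           := x :* y :- con 1ℤ) refl x (x ^ n) ⟩
    x * x ^ n - 1ℤ                            ∎
    where open ≡-Reasoning

  x-1∣x^n-1 : ∀ x n → x - 1ℤ ∣ᶻ x ^ n - 1ℤ
  x-1∣x^n-1 x n = divides (∑< n (x ^_)) (trans (sym (geometric x n)) (ℤP.*-comm (x - 1ℤ) _))

  x-1∣∑x^i-n : ∀ x n → x - 1ℤ ∣ᶻ (∑[ i < n ] x ^ i) - + n
  x-1∣∑x^i-n x zero    = divides 0ℤ refl
  x-1∣∑x^i-n x (suc n) = subst (x - 1ℤ ∣ᶻ_) split (ℤ∣.∣m∣n⇒∣m+n (x-1∣∑x^i-n x n) (x-1∣x^n-1 x n))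
    where
    split : ∑< n (x ^_) - + n + (x ^ n - 1ℤ) ≡ ∑< (suc n) (x ^_) - + suc n
    split = trans
      (solve 3 (λ s m y → s :- m :+ (y :- con 1ℤ) := s :+ y :- (con 1ℤ :+ m)) refl
        (∑< n (x ^_)) (+ n) (x ^ n))
      (cong₂ _-_ (sym (∑-init-last n (x ^_))) (sym (ℤP.pos-+ 1 n)))

  -- x ^ n - 1 = (x - 1) (1 + x + … + x ^ (n - 1)), and the second factor is ≡ n modulo x - 1.
  ∣x-1⇒*∣x^n-1 : ∀ {d} n x → + n ∣ᶻ d → d ∣ᶻ x - 1ℤ → d * + n ∣ᶻ x ^ n - 1ℤ
  ∣x-1⇒*∣x^n-1 {d} n x n∣d d∣x-1 = subst (d * + n ∣ᶻ_) (geometric x n)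
    (ℤ∣.∣-trans (ℤ∣.*-monoˡ-∣ (+ n) d∣x-1) (ℤ∣.*-monoʳ-∣ (x - 1ℤ) n∣∑x^i))
    where
    n∣∑x^i : + n ∣ᶻ ∑< n (x ^_)
    n∣∑x^i = subst (+ n ∣ᶻ_) (solve 2 (λ s m → s :- m :+ m := s) refl (∑< n (x ^_)) (+ n))
      (ℤ∣.∣m∣n⇒∣m+n (ℤ∣.∣-trans n∣d (ℤ∣.∣-trans d∣x-1 (x-1∣∑x^i-n x n))) ℤ∣.∣-refl)

  p∣x-1⇒p^[1+j]∣x^[p^j]-1 : ∀ p j x → + p ∣ᶻ x - 1ℤ → + (p ℕ.^ suc j) ∣ᶻ x ^ (p ℕ.^ j) - 1ℤ
  p∣x-1⇒p^[1+j]∣x^[p^j]-1 p zero    x p∣x-1 =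
    subst₂ (λ a y → + a ∣ᶻ y - 1ℤ) (sym (ℕP.*-identityʳ p)) (sym (ℤP.*-identityʳ x)) p∣x-1
  p∣x-1⇒p^[1+j]∣x^[p^j]-1 p (suc j) x p∣x-1 = subst₂ (λ a y → a ∣ᶻ y - 1ℤ) p^[1+j]*p≡p^[2+j] power≡
    (∣x-1⇒*∣x^n-1 p (x ^ (p ℕ.^ j)) (∣ᵤ⇒∣ (ℕ∣.m∣m*n (p ℕ.^ j)))
      (p∣x-1⇒p^[1+j]∣x^[p^j]-1 p j x p∣x-1))
    where
    p^[1+j]*p≡p^[2+j] : + (p ℕ.^ suc j) * + p ≡ + (p ℕ.^ suc (suc j))
    p^[1+j]*p≡p^[2+j] = trans (sym (ℤP.pos-* (p ℕ.^ suc j) p)) (cong +_ (ℕP.*-comm (p ℕ.^ suc j) p))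
    power≡ : (x ^ (p ℕ.^ j)) ^ p ≡ x ^ (p ℕ.^ suc j)
    power≡ = trans (ℤP.^-*-assoc x (p ℕ.^ j) p) (cong (x ^_) (ℕP.*-comm (p ℕ.^ j) p))

  ×ᶻ≡* : ∀ n y → n ×ᶻ y ≡ + n * y
  ×ᶻ≡* zero    y = sym (ℤP.*-zeroˡ y)
  ×ᶻ≡* (suc n) y = trans (cong (_+_ y) (×ᶻ≡* n y)) (sym (ℤP.suc-* (+ n) y))

  ^′≡^ : ∀ x n → x ^′ n ≡ x ^ n
  ^′≡^ x zero    = refl
  ^′≡^ x (suc n) = cong (x *_) (^′≡^ x n)

  sum≡∑ : ∀ n (f : ℕ → ℤ) → sum {n} (f ∘ toℕ) ≡ ∑< n f
  sum≡∑ zero    f = refl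
  sum≡∑ (suc n) f = cong (_+_ (f 0)) (sum≡∑ n (f ∘ suc))

  binomial : ∀ n x → (x + 1ℤ) ^ n ≡ ∑[ k < suc n ] + (n C k) * x ^ k
  binomial n x = begin
    (x + 1ℤ) ^ n                         ≡⟨ ^′≡^ (x + 1ℤ) n ⟨
    (x + 1ℤ) ^′ n                        ≡⟨ binomialTheorem n x 1ℤ ⟩
    sum {suc n} (term ∘ toℕ)             ≡⟨ sum≡∑ (suc n) term ⟩
    ∑< (suc n) term                      ≡⟨ ∑-cong {suc n} (λ {k} _ → term≡ k) ⟩
    ∑[ k < suc n ] + (n C k) * x ^ k     ∎
    where
    open ≡-Reasoning
    term : ℕ → ℤ
    term k = (n C k) ×ᶻ (x ^′ k * 1ℤ ^′ (n ℕ.∸ k))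
    term≡ : ∀ k → term k ≡ + (n C k) * x ^ k
    term≡ k = begin
      term k                                 ≡⟨ ×ᶻ≡* (n C k) _ ⟩
      + (n C k) * (x ^′ k * 1ℤ ^′ (n ℕ.∸ k)) ≡⟨ cong₂ (λ a b → + (n C k) * (a * b)) (^′≡^ x k)
                                                  (trans (^′≡^ 1ℤ (n ℕ.∸ k)) (ℤP.^-zeroˡ (n ℕ.∸ k))) ⟩
      + (n C k) * (x ^ k * 1ℤ)               ≡⟨ cong (+ (n C k) *_) (ℤP.*-identityʳ (x ^ k)) ⟩
      + (n C k) * x ^ k                      ∎

  prime∣[x+1]^p-x^p-1 : Prime p → ∀ x → + p ∣ᶻ (x + 1ℤ) ^ p - x ^ p - 1ℤ
  prime∣[x+1]^p-x^p-1 {p@(suc q)} pp x = subst (+ p ∣ᶻ_) middle≡ (∣-∑ {q} p∣term)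
    where
    term : ℕ → ℤ
    term k = + (p C k) * x ^ k
    p∣term : ∀ {k} → k < q → + p ∣ᶻ term (suc k)
    p∣term {k} k<q =
      ℤ∣.∣m⇒∣m*n (x ^ suc k) (∣ᵤ⇒∣ {+ p} {+ (p C suc k)} (prime∣pCk pp (s≤s z≤n) (s≤s k<q)))
    middle : ℤ
    middle = ∑[ k < q ] term (suc k)
    expansion : (x + 1ℤ) ^ p ≡ 1ℤ + (middle + x ^ p)
    expansion = trans (binomial p x) (cong (_+_ 1ℤ) (trans (∑-init-last q (term ∘ suc))
      (cong (_+_ middle) (trans (cong (λ c → + c * x ^ p) (nCn≡1 p)) (ℤP.*-identityˡ (x ^ p))))))
    middle≡ : middle ≡ (x + 1ℤ) ^ p - x ^ p - 1ℤ
    middle≡ = trans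
      (solve 2 (λ m y → m := con 1ℤ :+ (m :+ y) :- y :- con 1ℤ) refl middle (x ^ p))
      (cong (λ z → z - x ^ p - 1ℤ) (sym expansion))

  fermat : Prime p → ∀ x → + p ∣ᶻ (+ x) ^ p - + x
  fermat {suc q} pp zero    = divides 0ℤ refl
  fermat {p}     pp (suc x) = subst (+ p ∣ᶻ_) telescope
    (ℤ∣.∣m∣n⇒∣m+n (prime∣[x+1]^p-x^p-1 pp (+ x)) (fermat pp x))
    where
    telescope : (+ x + 1ℤ) ^ p - (+ x) ^ p - 1ℤ + ((+ x) ^ p - + x) ≡ (+ suc x) ^ p - + suc x
    telescope = trans
      (solve 3 (λ y z a → y :- z :- con 1ℤ :+ (z :- a) := y :- (a :+ con 1ℤ)) refl
        ((+ x + 1ℤ) ^ p) ((+ x) ^ p) (+ x))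
      (cong (λ a → a ^ p - a) (ℤP.+-comm (+ x) 1ℤ))

  fermat-coprime : Prime p → ¬ p ∣ x → + p ∣ᶻ (+ x) ^ ℕ.pred p - 1ℤ
  fermat-coprime {p@(suc q)} {x} pp p∤x with euclidsLemma x ∣ (+ x) ^ q - 1ℤ ∣ pp p∣x*∣x^q-1∣
    where
    p∣x*∣x^q-1∣ : p ∣ x ℕ.* ∣ (+ x) ^ q - 1ℤ ∣
    p∣x*∣x^q-1∣ = subst (p ∣_) (ℤP.abs-* (+ x) _) (∣⇒∣ᵤ (subst (+ p ∣ᶻ_)
      (solve 2 (λ a y → a :* y :- a := a :* (y :- con 1ℤ)) refl (+ x) ((+ x) ^ q)) (fermat pp x)))
  ... | inj₁ p∣x     = ⊥-elim (p∤x p∣x)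
  ... | inj₂ p∣x^q-1 = ∣ᵤ⇒∣ p∣x^q-1

  euler-primePower : Prime p → ¬ p ∣ x → ∀ j {n} → p ℕ.^ j ∣ n →
                     + (p ℕ.^ suc j) ∣ᶻ (+ x) ^ (ℕ.pred p ℕ.* n) - 1ℤ
  euler-primePower {p} {x} pp p∤x j (divides t refl) = subst (λ y → + (p ℕ.^ suc j) ∣ᶻ y - 1ℤ) power≡
    (ℤ∣.∣-trans (p∣x-1⇒p^[1+j]∣x^[p^j]-1 p j u (fermat-coprime pp p∤x)) (x-1∣x^n-1 (u ^ (p ℕ.^ j)) t))
    where
    u : ℤ
    u = (+ x) ^ ℕ.pred p
    power≡ : (u ^ (p ℕ.^ j)) ^ t ≡ (+ x) ^ (ℕ.pred p ℕ.* (t ℕ.* p ℕ.^ j))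
    power≡ = begin
      (u ^ (p ℕ.^ j)) ^ t
        ≡⟨ ℤP.^-*-assoc u (p ℕ.^ j) t ⟩
      u ^ (p ℕ.^ j ℕ.* t)
        ≡⟨ ℤP.^-*-assoc (+ x) (ℕ.pred p) _ ⟩
      (+ x) ^ (ℕ.pred p ℕ.* (p ℕ.^ j ℕ.* t))
        ≡⟨ cong (λ e → (+ x) ^ (ℕ.pred p ℕ.* e)) (ℕP.*-comm (p ℕ.^ j) t) ⟩
      (+ x) ^ (ℕ.pred p ℕ.* (t ℕ.* p ℕ.^ j))
        ∎
      where open ≡-Reasoning

module DoldCondition where

  open Divisibility
  open Möbius
  open FiniteSums
  open import Data.Nat using (zero; suc; s≤s; NonZero)
  open ℕ∣ using (∣-refl; ∣⇒≤; *-monoʳ-∣; *-cancelˡ-∣; ∣n⇒∣m*n)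
  open import Data.Nat.DivMod using (_/_; *-/-assoc; m*n/m*o≡n/o; m*[n/m]≡n)
  open import Data.Nat.Coprimality as Coprimality using (coprime-divisor)
  open import Data.Integer using (1ℤ; _+_; _-_; _*_; -_)
  open import Data.Integer.Divisibility.Signed as ℤ∣ using (∣ᵤ⇒∣; ∣⇒∣ᵤ) renaming (_∣_ to _∣ᶻ_)
  open import Data.Integer.Solver using (module +-*-Solver)
  open import Data.List.Properties using (map-upTo)
  open import Relation.Nullary.Decidable using (Dec; _×-dec_; ¬?)

  private
    variable
      j p : ℕ
      A : ℕ → ℤ

  DoldCongruences : (ℕ → ℤ) → Set
  DoldCongruences A = ∀ {p} → Prime p → ∀ j {n} → p ℕ.^ j ∣ n → + (p ℕ.^ suc j) ∣ᶻ A (p ℕ.* n) - A n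

  doldTerm : (ℕ → ℤ) → ℕ → ℕ → ℤ
  doldTerm A n zero    = 0ℤ
  doldTerm A n (suc k) = μ (suc k) * A (n / suc k) when (suc k ∣? n)

  doldSum≡∑ : ∀ A n → doldSum A n ≡ ∑[ k < n ] doldTerm A n (suc k)
  doldSum≡∑ A n = cong sumℤ (map-upTo (doldTerm A n ∘ suc) n)

  doldTerm≡ : ∀ A n d .{{_ : NonZero d}} → doldTerm A n d ≡ μ d * A (n / d) when (d ∣? n)
  doldTerm≡ A n (suc k) = refl

  CoprimeDivisor : ℕ → ℕ → ℕ → Set
  CoprimeDivisor p m d = d ∣ m × ¬ p ∣ d

  coprimeDivisor? : ∀ p m d → Dec (CoprimeDivisor p m d)
  coprimeDivisor? p m d = d ∣? m ×-dec ¬? (p ∣? d)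

  module _ {p} (pp : Prime p) (A : ℕ → ℤ) (m : ℕ) .{{_ : NonZero m}} where

    private
      n : ℕ
      n = p ℕ.* m
      instance
        p≢0 : NonZero p
        p≢0 = prime⇒nonZero pp
        p*d≢0 : ∀ {d} .{{_ : NonZero d}} → NonZero (p ℕ.* d)
        p*d≢0 {d} = ℕP.m*n≢0 p d

    doldSum-coprimePart :
      ∑[ k < n ] (doldTerm A n (suc k) when ¬? (p ∣? suc k))
        ≡ ∑[ k < m ] (μ (suc k) * A (p ℕ.* (m / suc k)) when coprimeDivisor? p m (suc k))
    doldSum-coprimePart = trans (∑-cong {n} (λ {k} _ → term≡ k (p ∣? suc k) (suc k ∣? m)))
      (∑-truncate (ℕP.m≤n*m m p) (λ {k} m≤k → when-no (coprimeDivisor? p m (suc k))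
        (λ (d∣m , _) → ℕP.<⇒≱ (s≤s m≤k) (∣⇒≤ d∣m))))
      where
      term≡ : ∀ k → Dec (p ∣ suc k) → Dec (suc k ∣ m) →
        doldTerm A n (suc k) when ¬? (p ∣? suc k)
          ≡ μ (suc k) * A (p ℕ.* (m / suc k)) when coprimeDivisor? p m (suc k)
      term≡ k (yes p∣d) _ = trans (when-no (¬? (p ∣? suc k)) (λ p∤d → p∤d p∣d))
        (sym (when-no (coprimeDivisor? p m (suc k)) (λ (_ , p∤d) → p∤d p∣d)))
      term≡ k (no p∤d) (yes d∣m) = begin
        doldTerm A n (suc k) when ¬? (p ∣? suc k)
          ≡⟨ when-yes (¬? (p ∣? suc k)) p∤d ⟩
        μ (suc k) * A (n / suc k) when (suc k ∣? n)
          ≡⟨ when-yes (suc k ∣? n) (∣n⇒∣m*n p d∣m) ⟩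
        μ (suc k) * A (n / suc k)
          ≡⟨ cong (λ i → μ (suc k) * A i) (*-/-assoc p d∣m) ⟩
        μ (suc k) * A (p ℕ.* (m / suc k))
          ≡⟨ when-yes (coprimeDivisor? p m (suc k)) (d∣m , p∤d) ⟨
        μ (suc k) * A (p ℕ.* (m / suc k)) when coprimeDivisor? p m (suc k)
          ∎
        where open ≡-Reasoning
      term≡ k (no p∤d) (no d∤m) = begin
        doldTerm A n (suc k) when ¬? (p ∣? suc k)
          ≡⟨ when-yes (¬? (p ∣? suc k)) p∤d ⟩
        μ (suc k) * A (n / suc k) when (suc k ∣? n)
          ≡⟨ when-no (suc k ∣? n) (d∤m ∘ coprime-divisor (Coprimality.sym (prime∤⇒coprime pp p∤d))) ⟩
        0ℤ
          ≡⟨ when-no (coprimeDivisor? p m (suc k)) (d∤m ∘ proj₁) ⟨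
        μ (suc k) * A (p ℕ.* (m / suc k)) when coprimeDivisor? p m (suc k)
          ∎
        where open ≡-Reasoning

    -- Only the multiples p d with p ∤ d survive, and μ (p d) = - μ d pairs them with the terms for d.
    doldSum-multiplePart :
      ∑[ k < n ] (doldTerm A n (suc k) when (p ∣? suc k))
        ≡ ∑[ k < m ] (- μ (suc k) * A (m / suc k) when coprimeDivisor? p m (suc k))
    doldSum-multiplePart = trans (∑-multiples p m (doldTerm A n))
      (∑-cong {m} (λ {k} _ →
        trans (doldTerm≡ A n (p ℕ.* suc k)) (term≡ (suc k) (suc k ∣? m) (p ∣? suc k))))
      where
      term≡ : ∀ d .{{_ : NonZero d}} → Dec (d ∣ m) → Dec (p ∣ d) →
        μ (p ℕ.* d) * A (n / (p ℕ.* d)) when (p ℕ.* d ∣? n) ≡ - μ d * A (m / d) when coprimeDivisor? p m d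
      term≡ d (no d∤m) _ = trans (when-no (p ℕ.* d ∣? n) (d∤m ∘ *-cancelˡ-∣ p))
        (sym (when-no (coprimeDivisor? p m d) (d∤m ∘ proj₁)))
      term≡ d (yes d∣m) (yes p∣d) = begin
        μ (p ℕ.* d) * A (n / (p ℕ.* d)) when (p ℕ.* d ∣? n)
          ≡⟨ when-yes (p ℕ.* d ∣? n) (*-monoʳ-∣ p d∣m) ⟩
        μ (p ℕ.* d) * A (n / (p ℕ.* d))
          ≡⟨ cong (_* A (n / (p ℕ.* d))) (μ-primeSquare pp (*-monoʳ-∣ p p∣d)) ⟩
        0ℤ
          ≡⟨ when-no (coprimeDivisor? p m d) (λ (_ , p∤d) → p∤d p∣d) ⟨
        - μ d * A (m / d) when coprimeDivisor? p m d
          ∎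
        where open ≡-Reasoning
      term≡ d (yes d∣m) (no p∤d) = begin
        μ (p ℕ.* d) * A (n / (p ℕ.* d)) when (p ℕ.* d ∣? n)
          ≡⟨ when-yes (p ℕ.* d ∣? n) (*-monoʳ-∣ p d∣m) ⟩
        μ (p ℕ.* d) * A (n / (p ℕ.* d))
          ≡⟨ cong₂ _*_ (μ-p*e pp p∤d) (cong A (m*n/m*o≡n/o p m d)) ⟩
        - μ d * A (m / d)
          ≡⟨ when-yes (coprimeDivisor? p m d) (d∣m , p∤d) ⟨
        - μ d * A (m / d) when coprimeDivisor? p m d
          ∎
        where open ≡-Reasoning

    doldSum-p* : doldSum A n ≡
      ∑[ k < m ] (μ (suc k) * (A (p ℕ.* (m / suc k)) - A (m / suc k)) when coprimeDivisor? p m (suc k))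
    doldSum-p* = begin
      doldSum A n
        ≡⟨ doldSum≡∑ A n ⟩
      ∑[ k < n ] doldTerm A n (suc k)
        ≡⟨ ∑-cong {n} (λ {k} _ → when-split (p ∣? suc k)) ⟩
      ∑[ k < n ] (coprimePart k) + (multiplePart k)
        ≡⟨ ∑-distrib-+ n coprimePart multiplePart ⟩
      ∑< n coprimePart + ∑< n multiplePart
        ≡⟨ cong₂ _+_ doldSum-coprimePart doldSum-multiplePart ⟩
      (∑[ k < m ] (x k when C k)) + (∑[ k < m ] (y k when C k))
        ≡⟨ ∑-distrib-+ m (λ k → x k when C k) (λ k → y k when C k) ⟨
      ∑[ k < m ] (x k when C k) + (y k when C k)
        ≡⟨ ∑-cong {m} (λ {k} _ → trans (when-+ (C k)) (cong (_when C k) (factor k))) ⟩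
      ∑[ k < m ] (μ (suc k) * (A (p ℕ.* (m / suc k)) - A (m / suc k)) when C k)
        ∎
      where
      open ≡-Reasoning
      open +-*-Solver
      coprimePart multiplePart x y : ℕ → ℤ
      coprimePart  k = doldTerm A n (suc k) when ¬? (p ∣? suc k)
      multiplePart k = doldTerm A n (suc k) when (p ∣? suc k)
      x k = μ (suc k) * A (p ℕ.* (m / suc k))
      y k = - μ (suc k) * A (m / suc k)
      C : ∀ k → Dec (CoprimeDivisor p m (suc k))
      C k = coprimeDivisor? p m (suc k)
      factor : ∀ k → x k + y k ≡ μ (suc k) * (A (p ℕ.* (m / suc k)) - A (m / suc k))
      factor k = solve 3 (λ u a b → u :* a :+ (:- u) :* b := u :* (a :- b)) refl
        (μ (suc k)) (A (p ℕ.* (m / suc k))) (A (m / suc k))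

  congruences⇒p^[1+j]∣doldSum : ∀ {m} → DoldCongruences A → Prime p → .{{_ : NonZero m}} →
                                p ℕ.^ j ∣ m → + (p ℕ.^ suc j) ∣ᶻ doldSum A (p ℕ.* m)
  congruences⇒p^[1+j]∣doldSum {A = A} {p = p} {j = j} {m} congruent pp pʲ∣m =
    subst (_ ∣ᶻ_) (sym (doldSum-p* pp A m)) (∣-∑ {m} (λ {k} _ → ∣-when (coprimeDivisor? p m (suc k))
      (λ (d∣m , p∤d) → ℤ∣.∣n⇒∣m*n (μ (suc k)) (congruent pp j (pʲ∣m/d d∣m p∤d)))))
    where
    pʲ∣m/d : ∀ {d} .{{_ : NonZero d}} → d ∣ m → ¬ p ∣ d → p ℕ.^ j ∣ m / d
    pʲ∣m/d d∣m p∤d = prime^k∣d*n⇒prime^k∣n pp p∤d j (subst (p ℕ.^ j ∣_) (sym (m*[n/m]≡n d∣m)) pʲ∣m)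

  congruences⇒Dold : DoldCongruences A → Dold A
  congruences⇒Dold {A} congruent n 1≤n = primePowers∣⇒∣ {{ℕ.>-nonZero 1≤n}} primePower∣doldSum
    where
    primePower∣doldSum : ∀ {p} k → Prime p → p ℕ.^ k ∣ n → p ℕ.^ k ∣ ℤ.∣ doldSum A n ∣
    primePower∣doldSum     zero    _  _    = ℕ∣.1∣ _
    primePower∣doldSum {p} (suc j) pp pᵏ∣n = subst (λ i → p ℕ.^ suc j ∣ ℤ.∣ doldSum A i ∣) (sym n≡p*m)
      (∣⇒∣ᵤ (congruences⇒p^[1+j]∣doldSum {A = A} {j = j} congruent pp pʲ∣m))
      where
      p∣n : p ∣ n
      p∣n = ℕ∣.m*n∣⇒m∣ p (p ℕ.^ j) pᵏ∣n
      m : ℕ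
      m = ℕ∣.quotient p∣n
      n≡p*m : n ≡ p ℕ.* m
      n≡p*m = ℕ∣.m∣n⇒n≡m*quotient p∣n
      instance
        m≢0 : NonZero m
        m≢0 = ℕ∣.quotient≢0 p∣n {{ℕ.>-nonZero 1≤n}}
      pʲ∣m : p ℕ.^ j ∣ m
      pʲ∣m = *-cancelˡ-∣ p {{prime⇒nonZero pp}} (subst (p ℕ.^ suc j ∣_) n≡p*m pᵏ∣n)

  doldSum-prime : Prime p → doldSum A p ≡ A p - A 1
  doldSum-prime {p} {A} pp = begin
    doldSum A p
      ≡⟨ cong (doldSum A) (ℕP.*-identityʳ p) ⟨
    doldSum A (p ℕ.* 1)
      ≡⟨ doldSum-p* pp A 1 ⟩
    (1ℤ * (A (p ℕ.* 1) - A 1) when coprimeDivisor? p 1 1) + 0ℤ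
      ≡⟨ ℤP.+-identityʳ _ ⟩
    1ℤ * (A (p ℕ.* 1) - A 1) when coprimeDivisor? p 1 1
      ≡⟨ when-yes (coprimeDivisor? p 1 1) (∣-refl , prime∤1 pp) ⟩
    1ℤ * (A (p ℕ.* 1) - A 1)
      ≡⟨ trans (ℤP.*-identityˡ _) (cong (λ i → A i - A 1) (ℕP.*-identityʳ p)) ⟩
    A p - A 1
      ∎
    where
    open ≡-Reasoning
    instance
      p≢0 : NonZero p
      p≢0 = prime⇒nonZero pp

  Dold⇒prime∣A[p]-A[1] : Dold A → Prime p → + p ∣ᶻ A p - A 1
  Dold⇒prime∣A[p]-A[1] {A} {p} dold pp = subst (+ p ∣ᶻ_) (doldSum-prime {A = A} pp)
    (∣ᵤ⇒∣ (dold p (ℕ.>-nonZero⁻¹ p {{prime⇒nonZero pp}})))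

module Sequence where

  open Divisibility
  open PowerCongruences
  open DoldCondition
  open import Data.Nat using (zero; suc)
  open import Data.Nat.Primality using (prime⇒nonTrivial; ¬prime[0])
  open import Data.Integer using (1ℤ; _+_; _-_; _*_; _^_)
  open import Data.Integer.Divisibility.Signed as ℤ∣ using (divides; ∣ᵤ⇒∣; ∣⇒∣ᵤ) renaming (_∣_ to _∣ᶻ_)
  open import Data.Integer.Solver using (module +-*-Solver)

  private
    variable
      c δ p : ℕ

  U : ℕ → ℕ → ℤ
  U δ zero    = 0ℤ
  U δ (suc m) = (+ δ) ^ m

  U-recurrence : ∀ δ n → U δ (suc (suc n)) ≡ + δ * U δ (suc n) + 0ℤ * U δ n
  U-recurrence δ n = sym (ℤP.+-identityʳ _)

  cU[pn]-cU[n] : ∀ c δ q m → + c * U δ (suc q ℕ.* suc m) - + c * U δ (suc m)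
                           ≡ + (c ℕ.* δ ℕ.^ m) * ((+ δ) ^ (q ℕ.* suc m) - 1ℤ)
  cU[pn]-cU[n] c δ q m = begin
    + c * (+ δ) ^ (m ℕ.+ q ℕ.* suc m) - + c * (+ δ) ^ m
      ≡⟨ cong (λ u → + c * u - + c * (+ δ) ^ m) (ℤP.^-distribˡ-+-* (+ δ) m (q ℕ.* suc m)) ⟩
    + c * ((+ δ) ^ m * (+ δ) ^ (q ℕ.* suc m)) - + c * (+ δ) ^ m
      ≡⟨ solve 3 (λ c a b → c :* (a :* b) :- c :* a := c :* a :* (b :- con 1ℤ)) refl (+ c) ((+ δ) ^ m) _ ⟩
    + c * (+ δ) ^ m * ((+ δ) ^ (q ℕ.* suc m) - 1ℤ)
      ≡⟨ cong (_* ((+ δ) ^ (q ℕ.* suc m) - 1ℤ))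
              (trans (ℤP.pos-* c (δ ℕ.^ m)) (cong (+ c *_) (pos-^ δ m))) ⟨
    + (c ℕ.* δ ℕ.^ m) * ((+ δ) ^ (q ℕ.* suc m) - 1ℤ)
      ∎
    where
    open ≡-Reasoning
    open +-*-Solver

  cU-congruences : (∀ {p} → Prime p → p ∣ δ → p ∣ c) → DoldCongruences (λ n → + c * U δ n)
  cU-congruences primes∣c {zero} pp = ⊥-elim (¬prime[0] pp)
  cU-congruences {δ} {c} primes∣c {p} pp j {zero} _ =
    subst (λ i → + (p ℕ.^ suc j) ∣ᶻ A i - A 0) (sym (ℕP.*-zeroʳ p))
      (subst (+ (p ℕ.^ suc j) ∣ᶻ_) (sym (ℤP.+-inverseʳ (A 0))) (divides 0ℤ refl))
    where
    A : ℕ → ℤ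
    A n = + c * U δ n
  cU-congruences {δ} {c} primes∣c {p@(suc q)} pp j {suc m} pʲ∣n
    rewrite cU[pn]-cU[n] c δ q m with p ∣? δ
  ... | yes p∣δ = ℤ∣.∣m⇒∣m*n _ (∣ᵤ⇒∣ {+ (p ℕ.^ suc j)} {+ (c ℕ.* δ ℕ.^ m)} p^[1+j]∣cδᵐ)
    where
    j≤m : j ℕ.≤ m
    j≤m = ℕP.≤-pred (ℕP.≤-trans (n<m^n (ℕ.nonTrivial⇒n>1 p {{prime⇒nonTrivial pp}}) j)
                                 (ℕ∣.∣⇒≤ pʲ∣n))
    p^[1+j]∣cδᵐ : p ℕ.^ suc j ∣ c ℕ.* δ ℕ.^ m
    p^[1+j]∣cδᵐ = ℕ∣.*-pres-∣ (primes∣c pp p∣δ) (ℕ∣.∣-trans (^-monoʳ-∣ p j≤m) (^-monoˡ-∣ m p∣δ))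
  ... | no p∤δ = ℤ∣.∣n⇒∣m*n (+ (c ℕ.* δ ℕ.^ m)) (euler-primePower pp p∤δ j pʲ∣n)

  Dold-cU⇒prime∣c : Dold (λ n → + c * U δ n) → Prime p → p ∣ δ → p ∣ c
  Dold-cU⇒prime∣c {p = zero}            _    pp _   = ⊥-elim (¬prime[0] pp)
  Dold-cU⇒prime∣c {p = suc zero}        _    pp _   = ⊥-elim (¬prime[1] pp)
  Dold-cU⇒prime∣c {c} {δ} {p@(suc (suc r))} dold pp p∣δ = ∣⇒∣ᵤ {+ p} {+ c} (subst (+ p ∣ᶻ_)
    (trans (ℤP.neg-involutive _) (ℤP.*-identityʳ (+ c)))
    (ℤ∣.∣m⇒∣-m (ℤ∣.∣m+n∣m⇒∣n (Dold⇒prime∣A[p]-A[1] {A = λ n → + c * U δ n} dold pp) p∣cU[p])))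
    where
    p∣cU[p] : + p ∣ᶻ + c * (+ δ) ^ suc r
    p∣cU[p] = ℤ∣.∣n⇒∣m*n (+ c) (ℤ∣.∣m⇒∣m*n ((+ δ) ^ r) (∣ᵤ⇒∣ {+ p} {+ δ} p∣δ))

open PrimeDivisors using (rad≥1; prime∣⇒∣rad; rad∣)
open DoldCondition using (congruences⇒Dold)
open Sequence using (U; U-recurrence; cU-congruences; Dold-cU⇒prime∣c)

theorem3 : ∀ (δ : ℕ) → 1 ≤ δ →
    ∃[ r₁ ] ∃[ r₂ ] ∃[ U ]
    ((∀ (n : ℕ) → U (ℕ.suc (ℕ.suc n)) ≡ r₁ ℤ.* U (ℕ.suc n) ℤ.+ r₂ ℤ.* U n)
    × (r₁ ℤ.* r₁ ℤ.+ + 4 ℤ.* r₂ ≡ + (δ ℕ.* δ))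
    × ∃[ c ] (IsFail U c × rad (δ ℕ.* δ) ∣ c))
theorem3 δ 1≤δ = + δ , 0ℤ , U δ , U-recurrence δ , discriminant , rad δ² , isFail , ℕ∣.∣-refl
  where
  δ² : ℕ
  δ² = δ ℕ.* δ
  instance
    δ²≢0 : ℕ.NonZero δ²
    δ²≢0 = ℕ.>-nonZero (ℕP.*-mono-≤ 1≤δ 1≤δ)
  discriminant : + δ ℤ.* + δ ℤ.+ + 4 ℤ.* 0ℤ ≡ + δ²
  discriminant = trans (ℤP.+-identityʳ _) (sym (ℤP.pos-* δ δ))
  prime∣δ²⇒prime∣δ : ∀ {p} → Prime p → p ∣ δ² → p ∣ δ
  prime∣δ²⇒prime∣δ pp p∣δ² with euclidsLemma δ δ pp p∣δ²
  ... | inj₁ p∣δ = p∣δ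
  ... | inj₂ p∣δ = p∣δ
  isFail : IsFail (U δ) (rad δ²)
  isFail = rad≥1 δ²
         , congruences⇒Dold {A = λ n → + rad δ² ℤ.* U δ n}
             (cU-congruences {δ = δ} (λ pp p∣δ → prime∣⇒∣rad pp (ℕ∣.∣m⇒∣m*n δ p∣δ)))
         , λ c 1≤c dold → ℕ∣.∣⇒≤ {{ℕ.>-nonZero 1≤c}}
             (rad∣ δ² (λ pp p∣δ² → Dold-cU⇒prime∣c {δ = δ} dold pp (prime∣δ²⇒prime∣δ pp p∣δ²)))
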